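{- Let $\mathcal{C}$ be a category with finite products and weak pullbacks. Then the cartesian bicategory $\mathrm{Span}^{\sim}(\mathcal{C})$ has enough maps.
   Context: Composition is diagrammatic ($R;S$ means first $R$ then $S$). A weak pullback is a commutative square satisfying the existence (not necessarily uniqueness) part of the pullback universal property. $\mathrm{Span}^{\sim}(\mathcal{C})$: for spans $X\leftarrow A\to Y$ in $\mathcal{C}$ set $(X\leftarrow A\to Y)\le(X\leftarrow B\to Y)$ iff some $\alpha\colon A\to B$ commutes with both legs; $s_1\sim s_2$ iff $s_1\le s_2\le s_1$. Objects are those of $\mathcal{C}$, morphisms are $\sim$-classes of spans ordered by $\le$, composition via weak pullbacks, identities $X\xleftarrow{\mathrm{id}}X\xrightarrow{\mathrm{id}}X$, monoidal product the product of $\mathcal{C}$ with unit $I=1$, $\delta_X=[X\xleftarrow{\mathrm{id}}X\xrightarrow{\Delta}X\times X]$, $\varepsilon_X=[X\xleftarrow{\mathrm{id}}X\to1]$, $\delta_X^*,\varepsilon_X^*$ the reversed spans. In a cartesian bicategory, for $R\colon X\to Y$: $R^{op}=(\mathrm{id}_Y\otimes(\varepsilon_X^*;\delta_X));(\mathrm{id}_Y\otimes R\otimes\mathrm{id}_X);((\delta_Y^*;\varepsilon_Y)\otimes\mathrm{id}_X)$; $R$ is a map if $\delta_X;(R\otimes R)\le R;\delta_Y$ and $\varepsilon_X\le R;\varepsilon_Y$. A cartesian bicategory has enough maps if for every morphism $R\colon X\to I$ there is a map $f\colon Z\to X$ with $R=f^{op};\varepsilon_Z$. -}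

module Defs where

open import Level using (Level; _⊔_) renaming (suc to lsuc)
open import Data.Product using (Σ; Σ-syntax; _×_; _,_)
open import Relation.Binary using (Rel; IsEquivalence)

-- Categories (hom-setoids), composition written diagrammatically: f ⨾ g
-- means "first f then g".

record Category (o ℓ e : Level) : Set (lsuc (o ⊔ ℓ ⊔ e)) where
  infix  4 _≈_
  infixr 4 _⇒_
  infixl 9 _⨾_
  field
    Obj   : Set o
    _⇒_   : Obj → Obj → Set ℓ
    _≈_   : ∀ {A B} → Rel (A ⇒ B) e
    id    : ∀ {A} → A ⇒ A
    _⨾_   : ∀ {A B C} → A ⇒ B → B ⇒ C → A ⇒ C
    ≈-equiv   : ∀ {A B} → IsEquivalence (_≈_ {A} {B})
    ⨾-resp-≈  : ∀ {A B C} {f f′ : A ⇒ B} {g g′ : B ⇒ C} →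
                f ≈ f′ → g ≈ g′ → f ⨾ g ≈ f′ ⨾ g′
    identityˡ : ∀ {A B} {f : A ⇒ B} → id ⨾ f ≈ f
    identityʳ : ∀ {A B} {f : A ⇒ B} → f ⨾ id ≈ f
    assoc     : ∀ {A B C D} {f : A ⇒ B} {g : B ⇒ C} {h : C ⇒ D} →
                (f ⨾ g) ⨾ h ≈ f ⨾ (g ⨾ h)

record FiniteProducts {o ℓ e} (𝒞 : Category o ℓ e) : Set (o ⊔ ℓ ⊔ e) where
  open Category 𝒞
  infixr 7 _⊗₀_
  field
    ⊤      : Obj
    !      : ∀ {A} → A ⇒ ⊤
    !-unique : ∀ {A} (f : A ⇒ ⊤) → f ≈ !
    _⊗₀_   : Obj → Obj → Obj
    π₁     : ∀ {A B} → A ⊗₀ B ⇒ A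
    π₂     : ∀ {A B} → A ⊗₀ B ⇒ B
    ⟨_,_⟩  : ∀ {A B C} → C ⇒ A → C ⇒ B → C ⇒ A ⊗₀ B
    project₁ : ∀ {A B C} {f : C ⇒ A} {g : C ⇒ B} → ⟨ f , g ⟩ ⨾ π₁ ≈ f
    project₂ : ∀ {A B C} {f : C ⇒ A} {g : C ⇒ B} → ⟨ f , g ⟩ ⨾ π₂ ≈ g
    ⟨⟩-unique : ∀ {A B C} {f : C ⇒ A} {g : C ⇒ B} {h : C ⇒ A ⊗₀ B} →
                h ⨾ π₁ ≈ f → h ⨾ π₂ ≈ g → h ≈ ⟨ f , g ⟩

record WeakPullback {o ℓ e} (𝒞 : Category o ℓ e)
                    {A B C : Category.Obj 𝒞}
                    (f : Category._⇒_ 𝒞 A C) (g : Category._⇒_ 𝒞 B C)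
                    : Set (o ⊔ ℓ ⊔ e) where
  open Category 𝒞
  field
    P       : Obj
    p₁      : P ⇒ A
    p₂      : P ⇒ B
    commute : p₁ ⨾ f ≈ p₂ ⨾ g
    mediate : ∀ {Q} (q₁ : Q ⇒ A) (q₂ : Q ⇒ B) → q₁ ⨾ f ≈ q₂ ⨾ g →
              Σ[ u ∈ Q ⇒ P ] ((u ⨾ p₁ ≈ q₁) × (u ⨾ p₂ ≈ q₂))

HasWeakPullbacks : ∀ {o ℓ e} → Category o ℓ e → Set (o ⊔ ℓ ⊔ e)
HasWeakPullbacks 𝒞 = ∀ {A B C} (f : A ⇒ C) (g : B ⇒ C) → WeakPullback 𝒞 f g
  where open Category 𝒞

-- The cartesian bicategory Span~(𝒞).  A morphism X → Y is represented by
-- a span; the quotient by ∼ is handled by using ∼ as the equality of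
-- morphisms (setoid style).

module SpanBicat {o ℓ e} (𝒞 : Category o ℓ e) (FP : FiniteProducts 𝒞)
                 (WP : HasWeakPullbacks 𝒞) where
  open Category 𝒞
  open FiniteProducts FP

  record Span (X Y : Obj) : Set (o ⊔ ℓ) where
    constructor span
    field
      apex : Obj
      left : apex ⇒ X
      right : apex ⇒ Y
  open Span public

  infix 4 _≤ˢ_ _∼_
  _≤ˢ_ : ∀ {X Y} → Span X Y → Span X Y → Set (ℓ ⊔ e)
  s ≤ˢ t = Σ[ α ∈ apex s ⇒ apex t ] ((α ⨾ left t ≈ left s) × (α ⨾ right t ≈ right s))

  _∼_ : ∀ {X Y} → Span X Y → Span X Y → Set (ℓ ⊔ e)
  s ∼ t = (s ≤ˢ t) × (t ≤ˢ s)

  infixl 9 _；_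
  _；_ : ∀ {X Y Z} → Span X Y → Span Y Z → Span X Z
  s ； t = span W.P (W.p₁ ⨾ left s) (W.p₂ ⨾ right t)
    where module W = WeakPullback (WP (right s) (left t))

  idˢ : ∀ {X} → Span X X
  idˢ {X} = span X id id

  graph : ∀ {A B} → A ⇒ B → Span A B
  graph {A} f = span A id f

  _ᵀ : ∀ {X Y} → Span X Y → Span Y X
  span A l r ᵀ = span A r l

  I : Obj
  I = ⊤

  _×₁_ : ∀ {A B C D} → A ⇒ B → C ⇒ D → A ⊗₀ C ⇒ B ⊗₀ D
  f ×₁ g = ⟨ π₁ ⨾ f , π₂ ⨾ g ⟩

  infixr 7 _⊗_
  _⊗_ : ∀ {X Y X′ Y′} → Span X Y → Span X′ Y′ → Span (X ⊗₀ X′) (Y ⊗₀ Y′)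
  s ⊗ t = span (apex s ⊗₀ apex t) (left s ×₁ left t) (right s ×₁ right t)

  δ : ∀ X → Span X (X ⊗₀ X)
  δ X = span X id ⟨ id , id ⟩

  ε : ∀ X → Span X I
  ε X = span X id !

  δ* : ∀ X → Span (X ⊗₀ X) X
  δ* X = δ X ᵀ

  ε* : ∀ X → Span I X
  ε* X = ε X ᵀ

  ρ⁻¹ : ∀ {Y} → Span Y (Y ⊗₀ I)
  ρ⁻¹ = graph ⟨ id , ! ⟩

  λ′ : ∀ {X} → Span (I ⊗₀ X) X
  λ′ = graph π₂

  α⁻¹ : ∀ {A B C} → Span (A ⊗₀ (B ⊗₀ C)) ((A ⊗₀ B) ⊗₀ C)
  α⁻¹ = graph ⟨ ⟨ π₁ , π₂ ⨾ π₁ ⟩ , π₂ ⨾ π₂ ⟩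

  -- R^op = (id_Y ⊗ (ε*_X ; δ_X)) ; (id_Y ⊗ R ⊗ id_X) ; ((δ*_Y ; ε_Y) ⊗ id_X)
  -- with the coherence isomorphisms made explicit.
  _ᵒᵖ : ∀ {X Y} → Span X Y → Span Y X
  _ᵒᵖ {X} {Y} R =
    ρ⁻¹
    ； (idˢ {Y} ⊗ (ε* X ； δ X))
    ； α⁻¹
    ； ((idˢ {Y} ⊗ R) ⊗ idˢ {X})
    ； ((δ* Y ； ε Y) ⊗ idˢ {X})
    ； λ′

  IsMap : ∀ {X Y} → Span X Y → Set (ℓ ⊔ e)
  IsMap {X} {Y} R = ((δ X ； (R ⊗ R)) ≤ˢ (R ； δ Y)) × (ε X ≤ˢ (R ； ε Y))

  EnoughMaps : Set (o ⊔ ℓ ⊔ e)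
  EnoughMaps = ∀ {X} (R : Span X I) →
    Σ[ Z ∈ Obj ] Σ[ f ∈ Span Z X ] (IsMap f × (R ∼ ((f ᵒᵖ) ； ε Z)))

-- Read a span X ← A → Y as the relation between generalised elements
-- x : Q ⇒ X, y : Q ⇒ Y that factor jointly through A.  The existence part of
-- the weak pullback property is exactly what makes composition of spans
-- relational composition; ⊗ is the product relation, and s ≤ t follows from
-- s ⊆ t applied to the generic element id of the apex of s.  In this reading
-- R ᵒᵖ is the converse of R (the snake equations for the self-duality given by
-- δ and ε).  So for R : X → I with apex A and left leg l, the graph of l is a
-- map whose converse followed by the total relation ε A is R.
module Submission where

open import Level using (_⊔_)
open import Data.Product using (Σ-syntax; _×_; _,_)
open import Relation.Binary using (IsEquivalence)
open import Defs

module SpanRelations {o ℓ e} (𝒞 : Category o ℓ e) (FP : FiniteProducts 𝒞)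
                     (WP : HasWeakPullbacks 𝒞) where
  open Category 𝒞
  open FiniteProducts FP
  open SpanBicat 𝒞 FP WP

  module ≈ {A B} = IsEquivalence (≈-equiv {A} {B})

  infixr 5 _∙_
  _∙_ : ∀ {A B} {f g h : A ⇒ B} → f ≈ g → g ≈ h → f ≈ h
  _∙_ = ≈.trans

  ⨾-congˡ : ∀ {A B C} {f : A ⇒ B} {g g′ : B ⇒ C} → g ≈ g′ → f ⨾ g ≈ f ⨾ g′
  ⨾-congˡ = ⨾-resp-≈ ≈.refl

  ⨾-congʳ : ∀ {A B C} {f f′ : A ⇒ B} {g : B ⇒ C} → f ≈ f′ → f ⨾ g ≈ f′ ⨾ g
  ⨾-congʳ p = ⨾-resp-≈ p ≈.refl

  !-unique₂ : ∀ {A} (f g : A ⇒ ⊤) → f ≈ g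
  !-unique₂ f g = !-unique f ∙ ≈.sym (!-unique g)

  ⟨⟩-cong : ∀ {A B C} {f f′ : C ⇒ A} {g g′ : C ⇒ B} →
            f ≈ f′ → g ≈ g′ → ⟨ f , g ⟩ ≈ ⟨ f′ , g′ ⟩
  ⟨⟩-cong p q = ⟨⟩-unique (project₁ ∙ p) (project₂ ∙ q)

  ⊗₀-ext : ∀ {A B C} {h k : C ⇒ A ⊗₀ B} →
           h ⨾ π₁ ≈ k ⨾ π₁ → h ⨾ π₂ ≈ k ⨾ π₂ → h ≈ k
  ⊗₀-ext p q = ⟨⟩-unique p q ∙ ≈.sym (⟨⟩-unique ≈.refl ≈.refl)

  ⨾-project₁ : ∀ {A B C D} {h : D ⇒ C} {f : C ⇒ A} {g : C ⇒ B} →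
               h ⨾ ⟨ f , g ⟩ ⨾ π₁ ≈ h ⨾ f
  ⨾-project₁ = assoc ∙ ⨾-congˡ project₁

  ⨾-project₂ : ∀ {A B C D} {h : D ⇒ C} {f : C ⇒ A} {g : C ⇒ B} →
               h ⨾ ⟨ f , g ⟩ ⨾ π₂ ≈ h ⨾ g
  ⨾-project₂ = assoc ∙ ⨾-congˡ project₂

  ⨾-⟨⟩ : ∀ {A B C D} {h : D ⇒ C} {f : C ⇒ A} {g : C ⇒ B} →
         h ⨾ ⟨ f , g ⟩ ≈ ⟨ h ⨾ f , h ⨾ g ⟩
  ⨾-⟨⟩ = ⟨⟩-unique ⨾-project₁ ⨾-project₂

  ⨾-×₁-π₁ : ∀ {A B C D E} {f : A ⇒ B} {g : C ⇒ D} {h : E ⇒ A ⊗₀ C} →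
            h ⨾ (f ×₁ g) ⨾ π₁ ≈ h ⨾ π₁ ⨾ f
  ⨾-×₁-π₁ = ⨾-project₁ ∙ ≈.sym assoc

  ⨾-×₁-π₂ : ∀ {A B C D E} {f : A ⇒ B} {g : C ⇒ D} {h : E ⇒ A ⊗₀ C} →
            h ⨾ (f ×₁ g) ⨾ π₂ ≈ h ⨾ π₂ ⨾ g
  ⨾-×₁-π₂ = ⨾-project₂ ∙ ≈.sym assoc

  record Relates {X Y} (s : Span X Y) {Q} (x : Q ⇒ X) (y : Q ⇒ Y) : Set (ℓ ⊔ e) where
    constructor relates
    field
      witness       : Q ⇒ apex s
      witness-left  : witness ⨾ left s ≈ x
      witness-right : witness ⨾ right s ≈ y

  Relates-resp : ∀ {X Y Q} {s : Span X Y} {x x′ : Q ⇒ X} {y y′ : Q ⇒ Y} →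
                 x ≈ x′ → y ≈ y′ → Relates s x y → Relates s x′ y′
  Relates-resp p q (relates a al ar) = relates a (al ∙ p) (ar ∙ q)

  ≤ˢ-from-Relates : ∀ {X Y} {s t : Span X Y} →
                    (∀ {Q} {x : Q ⇒ X} {y : Q ⇒ Y} → Relates s x y → Relates t x y) →
                    s ≤ˢ t
  ≤ˢ-from-Relates {s = s} s⊆t with s⊆t (relates {s = s} id identityˡ identityˡ)
  ... | relates α αl αr = α , αl , αr

  infixl 9 _；ᴿ_
  _；ᴿ_ : ∀ {X Y Z Q} {s : Span X Y} {t : Span Y Z}
            {x : Q ⇒ X} {y : Q ⇒ Y} {z : Q ⇒ Z} →
          Relates s x y → Relates t y z → Relates (s ； t) x z
  _；ᴿ_ {s = s} {t} (relates a al ar) (relates b bl br)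
    with WeakPullback.mediate (WP (right s) (left t)) a b (ar ∙ ≈.sym bl)
  ... | u , u₁ , u₂ = relates u (≈.sym assoc ∙ ⨾-congʳ u₁ ∙ al)
                                (≈.sym assoc ∙ ⨾-congʳ u₂ ∙ br)

  ；-elim : ∀ {X Y Z Q} {s : Span X Y} {t : Span Y Z} {x : Q ⇒ X} {z : Q ⇒ Z} →
            Relates (s ； t) x z → Σ[ y ∈ Q ⇒ Y ] (Relates s x y × Relates t y z)
  ；-elim {s = s} {t} (relates u ul ur) =
    u ⨾ p₁ ⨾ right s ,
    relates (u ⨾ p₁) (assoc ∙ ul) ≈.refl ,
    relates (u ⨾ p₂) (assoc ∙ ⨾-congˡ (≈.sym commute) ∙ ≈.sym assoc) (assoc ∙ ur)
    where open WeakPullback (WP (right s) (left t))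

  ⊗-intro : ∀ {X Y X′ Y′ Q} {s : Span X Y} {t : Span X′ Y′}
              {u : Q ⇒ X ⊗₀ X′} {v : Q ⇒ Y ⊗₀ Y′} →
            Relates s (u ⨾ π₁) (v ⨾ π₁) → Relates t (u ⨾ π₂) (v ⨾ π₂) →
            Relates (s ⊗ t) u v
  ⊗-intro (relates a al ar) (relates b bl br) =
    relates ⟨ a , b ⟩
      (⊗₀-ext (⨾-×₁-π₁ ∙ ⨾-congʳ project₁ ∙ al) (⨾-×₁-π₂ ∙ ⨾-congʳ project₂ ∙ bl))
      (⊗₀-ext (⨾-×₁-π₁ ∙ ⨾-congʳ project₁ ∙ ar) (⨾-×₁-π₂ ∙ ⨾-congʳ project₂ ∙ br))

  infixr 7 _⊗ᴿ_
  _⊗ᴿ_ : ∀ {X Y X′ Y′ Q} {s : Span X Y} {t : Span X′ Y′}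
           {x : Q ⇒ X} {y : Q ⇒ Y} {x′ : Q ⇒ X′} {y′ : Q ⇒ Y′} →
         Relates s x y → Relates t x′ y′ → Relates (s ⊗ t) ⟨ x , x′ ⟩ ⟨ y , y′ ⟩
  r ⊗ᴿ r′ = ⊗-intro (Relates-resp (≈.sym project₁) (≈.sym project₁) r)
                    (Relates-resp (≈.sym project₂) (≈.sym project₂) r′)

  ⊗-elim : ∀ {X Y X′ Y′ Q} {s : Span X Y} {t : Span X′ Y′}
             {u : Q ⇒ X ⊗₀ X′} {v : Q ⇒ Y ⊗₀ Y′} →
           Relates (s ⊗ t) u v →
           Relates s (u ⨾ π₁) (v ⨾ π₁) × Relates t (u ⨾ π₂) (v ⨾ π₂)
  ⊗-elim (relates c cl cr) =
    relates (c ⨾ π₁) (≈.sym ⨾-×₁-π₁ ∙ ⨾-congʳ cl) (≈.sym ⨾-×₁-π₁ ∙ ⨾-congʳ cr) ,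
    relates (c ⨾ π₂) (≈.sym ⨾-×₁-π₂ ∙ ⨾-congʳ cl) (≈.sym ⨾-×₁-π₂ ∙ ⨾-congʳ cr)

  ᵀ-swap : ∀ {X Y Q} {s : Span X Y} {x : Q ⇒ Y} {y : Q ⇒ X} →
           Relates (s ᵀ) x y → Relates s y x
  ᵀ-swap (relates a al ar) = relates a ar al

  graph-intro : ∀ {A B Q} {f : A ⇒ B} {x : Q ⇒ A} {y : Q ⇒ B} →
                x ⨾ f ≈ y → Relates (graph f) x y
  graph-intro {x = x} p = relates x identityʳ p

  graph-elim : ∀ {A B Q} {f : A ⇒ B} {x : Q ⇒ A} {y : Q ⇒ B} →
               Relates (graph f) x y → x ⨾ f ≈ y
  graph-elim (relates a al ar) = ⨾-congʳ (≈.sym al ∙ identityʳ) ∙ ar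

  graph⟨⟩-elim : ∀ {A B C Q} {f : A ⇒ B} {g : A ⇒ C} {x : Q ⇒ A} {u : Q ⇒ B ⊗₀ C} →
                 Relates (graph ⟨ f , g ⟩) x u → (u ⨾ π₁ ≈ x ⨾ f) × (u ⨾ π₂ ≈ x ⨾ g)
  graph⟨⟩-elim r = ⨾-congʳ (≈.sym (graph-elim r)) ∙ ⨾-project₁ ,
                   ⨾-congʳ (≈.sym (graph-elim r)) ∙ ⨾-project₂

  idˢ-refl : ∀ {X Q} {x : Q ⇒ X} → Relates idˢ x x
  idˢ-refl = graph-intro identityʳ

  idˢ-elim : ∀ {X Q} {x y : Q ⇒ X} → Relates idˢ x y → x ≈ y
  idˢ-elim r = ≈.sym identityʳ ∙ graph-elim r

  ε-total : ∀ {X Q} {x : Q ⇒ X} {t : Q ⇒ I} → Relates (ε X) x t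
  ε-total {x = x} = relates x identityʳ (!-unique₂ _ _)

  δ-intro : ∀ {X Q} {x : Q ⇒ X} → Relates (δ X) x ⟨ x , x ⟩
  δ-intro = graph-intro (⨾-⟨⟩ ∙ ⟨⟩-cong identityʳ identityʳ)

  δ-elim : ∀ {X Q} {x : Q ⇒ X} {u : Q ⇒ X ⊗₀ X} →
           Relates (δ X) x u → u ⨾ π₁ ≈ u ⨾ π₂
  δ-elim r with graph⟨⟩-elim r
  ... | u₁≈x , u₂≈x = u₁≈x ∙ ≈.sym u₂≈x

  α⁻¹-intro : ∀ {A B C Q} {x : Q ⇒ A} {y : Q ⇒ B} {z : Q ⇒ C} →
              Relates α⁻¹ ⟨ x , ⟨ y , z ⟩ ⟩ ⟨ ⟨ x , y ⟩ , z ⟩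
  α⁻¹-intro {x = x} {y} {z} =
    graph-intro (⨾-⟨⟩ ∙ ⟨⟩-cong (⨾-⟨⟩ ∙ ⟨⟩-cong project₁ to-y) to-z)
    where
      to-y : ⟨ x , ⟨ y , z ⟩ ⟩ ⨾ (π₂ ⨾ π₁) ≈ y
      to-y = ≈.sym assoc ∙ ⨾-congʳ project₂ ∙ project₁
      to-z : ⟨ x , ⟨ y , z ⟩ ⟩ ⨾ (π₂ ⨾ π₂) ≈ z
      to-z = ≈.sym assoc ∙ ⨾-congʳ project₂ ∙ project₂

  α⁻¹-elim : ∀ {A B C Q} {u : Q ⇒ A ⊗₀ (B ⊗₀ C)} {v : Q ⇒ (A ⊗₀ B) ⊗₀ C} →
             Relates α⁻¹ u v →
             (v ⨾ π₁ ⨾ π₁ ≈ u ⨾ π₁) × (v ⨾ π₁ ⨾ π₂ ≈ u ⨾ π₂ ⨾ π₁) × (v ⨾ π₂ ≈ u ⨾ π₂ ⨾ π₂)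
  α⁻¹-elim r with graph⟨⟩-elim r
  ... | v₁ , v₂ = ⨾-congʳ v₁ ∙ ⨾-project₁ ,
                  ⨾-congʳ v₁ ∙ ⨾-project₂ ∙ ≈.sym assoc ,
                  v₂ ∙ ≈.sym assoc

  cup : ∀ X → Span I (X ⊗₀ X)
  cup X = ε* X ； δ X

  cap : ∀ X → Span (X ⊗₀ X) I
  cap X = δ* X ； ε X

  cup-intro : ∀ {X Q} {t : Q ⇒ I} {x : Q ⇒ X} → Relates (cup X) t ⟨ x , x ⟩
  cup-intro = ᵀ-swap ε-total ；ᴿ δ-intro

  cup-elim : ∀ {X Q} {t : Q ⇒ I} {u : Q ⇒ X ⊗₀ X} → Relates (cup X) t u → u ⨾ π₁ ≈ u ⨾ π₂
  cup-elim r with ；-elim r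
  ... | _ , _ , r-δ = δ-elim r-δ

  cap-intro : ∀ {X Q} {x : Q ⇒ X} {t : Q ⇒ I} → Relates (cap X) ⟨ x , x ⟩ t
  cap-intro = ᵀ-swap δ-intro ；ᴿ ε-total

  cap-elim : ∀ {X Q} {u : Q ⇒ X ⊗₀ X} {t : Q ⇒ I} → Relates (cap X) u t → u ⨾ π₁ ≈ u ⨾ π₂
  cap-elim r with ；-elim r
  ... | _ , r-δ* , _ = δ-elim (ᵀ-swap r-δ*)

  ᵒᵖ-intro : ∀ {X Y Q} {s : Span X Y} {x : Q ⇒ Y} {y : Q ⇒ X} →
             Relates s y x → Relates (s ᵒᵖ) x y
  ᵒᵖ-intro {x = x} {y} r =
    ρ⁻¹-intro ；ᴿ (idˢ-refl ⊗ᴿ cup-intro {x = y}) ；ᴿ α⁻¹-intro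
              ；ᴿ ((idˢ-refl ⊗ᴿ r) ⊗ᴿ idˢ-refl) ；ᴿ (cap-intro {t = !} ⊗ᴿ idˢ-refl)
              ；ᴿ graph-intro project₂
    where
      ρ⁻¹-intro : Relates ρ⁻¹ x ⟨ x , ! ⟩
      ρ⁻¹-intro = graph-intro (⨾-⟨⟩ ∙ ⟨⟩-cong identityʳ (!-unique₂ _ _))

  -- The cup's common value is carried along the lower wire to the output y,
  -- and the cap equates the output of s with the input x on the upper wire.
  ᵒᵖ-elim : ∀ {X Y Q} {s : Span X Y} {x : Q ⇒ Y} {y : Q ⇒ X} →
            Relates (s ᵒᵖ) x y → Relates s y x
  ᵒᵖ-elim r =
    let _ , r₁₋₅ , r-λ′ = ；-elim r
        _ , r₁₋₄ , r-cap⊗id = ；-elim r₁₋₅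
        _ , r₁₋₃ , r-id⊗s⊗id = ；-elim r₁₋₄
        _ , r₁₋₂ , r-α⁻¹ = ；-elim r₁₋₃
        _ , r-ρ⁻¹ , r-id⊗cup = ；-elim r₁₋₂
        ρ₁ , _ = graph⟨⟩-elim r-ρ⁻¹
        r-id₁ , r-cup = ⊗-elim r-id⊗cup
        α₁ , α₂ , α₃ = α⁻¹-elim r-α⁻¹
        r-id⊗s , r-id₂ = ⊗-elim r-id⊗s⊗id
        r-id₃ , r-s = ⊗-elim r-id⊗s
        r-cap , r-id₄ = ⊗-elim r-cap⊗id
    in Relates-resp
         (α₂ ∙ cup-elim r-cup ∙ ≈.sym α₃ ∙ idˢ-elim r-id₂ ∙ idˢ-elim r-id₄ ∙ graph-elim r-λ′)
         (≈.sym (cap-elim r-cap) ∙ ≈.sym (idˢ-elim r-id₃) ∙ α₁ ∙ ≈.sym (idˢ-elim r-id₁)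
           ∙ ρ₁ ∙ identityʳ)
         r-s

  graph-isMap : ∀ {A B} (f : A ⇒ B) → IsMap (graph f)
  graph-isMap {A} {B} f =
    ≤ˢ-from-Relates δ；f⊗f⊆f；δ , ≤ˢ-from-Relates (λ _ → graph-intro ≈.refl ；ᴿ ε-total)
    where
      δ；f⊗f⊆f；δ : ∀ {Q} {x : Q ⇒ A} {v : Q ⇒ B ⊗₀ B} →
                    Relates (δ A ； (graph f ⊗ graph f)) x v → Relates (graph f ； δ B) x v
      δ；f⊗f⊆f；δ r =
        let _ , r-δ , r-f⊗f = ；-elim r
            u₁≈x , u₂≈x = graph⟨⟩-elim r-δ
            r-f₁ , r-f₂ = ⊗-elim r-f⊗f
        in graph-intro ≈.refl ；ᴿ graph-intro (⊗₀-ext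
             (⨾-project₁ ∙ identityʳ ∙ ⨾-congʳ (≈.sym (u₁≈x ∙ identityʳ)) ∙ graph-elim r-f₁)
             (⨾-project₂ ∙ identityʳ ∙ ⨾-congʳ (≈.sym (u₂≈x ∙ identityʳ)) ∙ graph-elim r-f₂))

proposition5p6 : ∀ {o ℓ e} (𝒞 : Category o ℓ e) (FP : FiniteProducts 𝒞)
                 (WP : HasWeakPullbacks 𝒞) → SpanBicat.EnoughMaps 𝒞 FP WP
proposition5p6 𝒞 FP WP {X} R =
  apex R , graph (left R) , graph-isMap (left R) ,
  ≤ˢ-from-Relates R⊆graphᵒᵖ；ε , ≤ˢ-from-Relates graphᵒᵖ；ε⊆R
  where
    open Category 𝒞
    open SpanBicat 𝒞 FP WP
    open SpanRelations 𝒞 FP WP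

    R⊆graphᵒᵖ；ε : ∀ {Q} {x : Q ⇒ X} {t : Q ⇒ I} →
                    Relates R x t → Relates (graph (left R) ᵒᵖ ； ε (apex R)) x t
    R⊆graphᵒᵖ；ε (relates a al _) = ᵒᵖ-intro (graph-intro al) ；ᴿ ε-total

    graphᵒᵖ；ε⊆R : ∀ {Q} {x : Q ⇒ X} {t : Q ⇒ I} →
                    Relates (graph (left R) ᵒᵖ ； ε (apex R)) x t → Relates R x t
    graphᵒᵖ；ε⊆R r =
      let a , r-ᵒᵖ , _ = ；-elim r
      in relates a (graph-elim (ᵒᵖ-elim r-ᵒᵖ)) (!-unique₂ _ _)
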